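{- Let $G$ be a connected claw-free graph with an odd number of vertices. Then $G$ is equimatchable if and only if for every independent set $I$ of $G$ with $|I|=3$, the graph $G\setminus I$ has at least two connected components with an odd number of vertices.
   Context: A graph is equimatchable if all its maximal matchings have the same cardinality; claw-free if it has no induced $K_{1,3}$. -}

module Defs where

open import Data.Nat using (ℕ; _%_)
open import Data.Fin using (Fin)
open import Data.Bool using (Bool; true; false)
open import Data.List using (List; []; _∷_; length; concatMap)
open import Data.List.Relation.Unary.Unique.Propositional using (Unique)
open import Data.List.Relation.Unary.All using (All)
open import Data.List.Membership.Propositional using (_∈_; _∉_)
open import Data.Product using (_×_; _,_; Σ; ∃; ∃-syntax)
open import Data.Unit using (⊤)
open import Data.Empty using (⊥)
open import Relation.Nullary using (¬_)
open import Relation.Binary.PropositionalEquality using (_≡_; _≢_)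
open import Function.Bundles using (_⇔_)

record Graph (n : ℕ) : Set where
  field
    adj    : Fin n → Fin n → Bool
    sym    : ∀ u v → adj u v ≡ adj v u
    irrefl : ∀ v → adj v v ≡ false
open Graph public

Adj : ∀ {n} → Graph n → Fin n → Fin n → Set
Adj G u v = adj G u v ≡ true

Odd : ℕ → Set
Odd m = m % 2 ≡ 1

-- Paths inside the set of vertices satisfying P (i.e. in the induced subgraph G[P]).
data Reach {n} (G : Graph n) (P : Fin n → Set) (u : Fin n) : Fin n → Set where
  here : P u → Reach G P u u
  step : ∀ {w v} → Reach G P u w → Adj G w v → P v → Reach G P u v

Connected : ∀ {n} → Graph n → Set
Connected G = ∀ u v → Reach G (λ _ → ⊤) u v

ClawFree : ∀ {n} → Graph n → Set
ClawFree G = ∀ c x y z → Adj G c x → Adj G c y → Adj G c z →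
  x ≢ y → x ≢ z → y ≢ z →
  ¬ (¬ Adj G x y × ¬ Adj G x z × ¬ Adj G y z)

endpoints : ∀ {n} → List (Fin n × Fin n) → List (Fin n)
endpoints = concatMap (λ { (u , v) → u ∷ v ∷ [] })

IsMatching : ∀ {n} → Graph n → List (Fin n × Fin n) → Set
IsMatching G M = All (λ { (u , v) → Adj G u v }) M × Unique (endpoints M)

IsMaximalMatching : ∀ {n} → Graph n → List (Fin n × Fin n) → Set
IsMaximalMatching G M = IsMatching G M ×
  (∀ u v → Adj G u v → u ∉ endpoints M → v ∉ endpoints M → ⊥)

Equimatchable : ∀ {n} → Graph n → Set
Equimatchable G = ∀ M M′ → IsMaximalMatching G M → IsMaximalMatching G M′ →
  length M ≡ length M′

Independent3 : ∀ {n} → Graph n → Fin n → Fin n → Fin n → Set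
Independent3 G a b c = a ≢ b × a ≢ c × b ≢ c ×
  ¬ Adj G a b × ¬ Adj G a c × ¬ Adj G b c

Outside : ∀ {n} → Fin n → Fin n → Fin n → Fin n → Set
Outside a b c v = v ≢ a × v ≢ b × v ≢ c

-- The component of x in G[P] has cardinality m: it is exactly the
-- set of elements of a duplicate-free list of length m.
ComponentSize : ∀ {n} → Graph n → (Fin n → Set) → Fin n → ℕ → Set
ComponentSize G P x m = Σ (List _) λ L →
  Unique L × (∀ v → (v ∈ L) ⇔ Reach G P x v) × length L ≡ m

OddComponent : ∀ {n} → Graph n → (Fin n → Set) → Fin n → Set
OddComponent G P x = P x × ∃[ m ] (ComponentSize G P x m × Odd m)

AtLeastTwoOddComponents : ∀ {n} → Graph n → (Fin n → Set) → Set
AtLeastTwoOddComponents G P = ∃[ x ] ∃[ y ]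
  (OddComponent G P x × OddComponent G P y × ¬ Reach G P x y)

module Submission where

-- In a claw-free graph a matching of an induced subgraph G[S] can be enlarged, keeping all its
-- vertices covered, whenever two free vertices lie in one component of G[S]: if the vertex w before
-- the last one on a connecting path is matched to q, the only way to avoid a claw centred at w is an
-- edge that shortens the path or lets w or q be rematched. So G[S] has a matching with at most one
-- free vertex per component, and a component containing a free vertex is odd; for S = V(G) this is
-- a maximal matching of size (n - 1)/2.
-- If G is equimatchable and {a, b, c} is independent, such a matching of G - {a, b, c} leaves some
-- vertex of G - {a, b, c} free, since otherwise it would be a maximal matching of G of size
-- (n - 3)/2; by parity it leaves two, and they lie in distinct odd components. Conversely, a
-- maximal matching with three or more free vertices could be augmented until exactly three free
-- vertices a, b, c remain; they are independent by maximality, and every component of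
-- G - {a, b, c} would be perfectly matched, hence even.

open import Defs renaming (sym to adj-comm)
open import Data.Nat using (ℕ; zero; suc; _+_; _*_; _≤_; _<_; z≤n; s≤s; _%_)
open import Data.Nat.Properties hiding (_≟_)
open import Data.Nat.DivMod using ([m+kn]%n≡m%n)
open import Data.Fin using (Fin; _≟_)
open import Data.List using (List; []; _∷_; _++_; length; filter; allFin)
open import Data.List.Properties using (length-++; length-tabulate; filter-notAll)
open import Data.List.Relation.Unary.Unique.Propositional using (Unique; []; _∷_)
import Data.List.Relation.Unary.Unique.Propositional.Properties as Unique
open import Data.List.Relation.Unary.All as All using (All; []; _∷_)
open import Data.List.Relation.Unary.All.Properties.Core using (¬Any⇒All¬; All¬⇒¬Any)
open import Data.List.Relation.Unary.Any as Any using (Any; here; there; any?; satisfied)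
open import Data.List.Relation.Binary.Subset.Propositional using (_⊆_)
open import Data.List.Membership.Propositional using (_∈_; _∉_; lose; find)
open import Data.List.Membership.Propositional.Properties
  using (∈-filter⁺; ∈-filter⁻; ∈-allFin; ∈-++⁺ˡ; ∈-++⁺ʳ; ∈-length)
open import Data.Product using (_×_; _,_; ∃-syntax; proj₁; proj₂; map₂)
open import Data.Sum using (_⊎_; inj₁; inj₂)
open import Data.Empty using (⊥; ⊥-elim)
open import Data.Unit using (⊤; tt)
open import Data.Bool using (true)
open import Data.Bool.Properties using () renaming (_≟_ to _≟ᵇ_)
open import Relation.Nullary using (¬_; Dec; yes; no; ¬?; _×-dec_)
open import Relation.Nullary.Decidable using (map′)
open import Relation.Unary using (Decidable)
open import Relation.Binary.PropositionalEquality
open import Function.Bundles using (_⇔_; mk⇔; Equivalence)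

Edge : ℕ → Set
Edge n = Fin n × Fin n

module _ {n : ℕ} where

  open import Data.List.Membership.DecPropositional (_≟_ {n}) using (_∈?_)

  remove : Fin n → List (Fin n) → List (Fin n)
  remove z = filter (λ w → ¬? (w ≟ z))

  ∈-remove⁺ : ∀ {z w L} → w ∈ L → w ≢ z → w ∈ remove z L
  ∈-remove⁺ {z} = ∈-filter⁺ (λ w → ¬? (w ≟ z))

  ∈-remove⁻ : ∀ {z w L} → w ∈ remove z L → w ∈ L × w ≢ z
  ∈-remove⁻ {z} = ∈-filter⁻ (λ w → ¬? (w ≟ z))

  remove-unique : ∀ {z L} → Unique L → Unique (remove z L)
  remove-unique {z} = Unique.filter⁺ (λ w → ¬? (w ≟ z))

  length-remove< : ∀ {z L} → z ∈ L → length (remove z L) < length L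
  length-remove< {z} {L} z∈L =
    filter-notAll (λ w → ¬? (w ≟ z)) L (Any.map (λ z≡w w≢z → w≢z (sym z≡w)) z∈L)

  ∈-∉⇒≢ : ∀ {x y} {L : List (Fin n)} → x ∈ L → y ∉ L → x ≢ y
  ∈-∉⇒≢ x∈L y∉L refl = y∉L x∈L

  unique-⊆⇒length≤ : ∀ {xs ys : List (Fin n)} → Unique xs → xs ⊆ ys → length xs ≤ length ys
  unique-⊆⇒length≤ {[]} _ _ = z≤n
  unique-⊆⇒length≤ {x ∷ xs} {ys} (x∉xs ∷ xs!) xs⊆ys = begin
    suc (length xs)            ≤⟨ s≤s (unique-⊆⇒length≤ xs! xs⊆remove) ⟩
    suc (length (remove x ys)) ≤⟨ length-remove< (xs⊆ys (here refl)) ⟩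
    length ys                  ∎
    where
    open ≤-Reasoning
    xs⊆remove : xs ⊆ remove x ys
    xs⊆remove w∈xs = ∈-remove⁺ (xs⊆ys (there w∈xs)) (λ w≡x → All.lookup x∉xs w∈xs (sym w≡x))

  unique-⊆⊇⇒length≡ : ∀ {xs ys : List (Fin n)} → Unique xs → Unique ys →
                      xs ⊆ ys → ys ⊆ xs → length xs ≡ length ys
  unique-⊆⊇⇒length≡ xs! ys! xs⊆ys ys⊆xs =
    ≤-antisym (unique-⊆⇒length≤ xs! xs⊆ys) (unique-⊆⇒length≤ ys! ys⊆xs)

  length-remove : ∀ {z L} → Unique L → z ∈ L → length L ≡ suc (length (remove z L))
  length-remove {z} {L} L! z∈L = ≤-antisym (unique-⊆⇒length≤ L! L⊆) (length-remove< z∈L)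
    where
    L⊆ : L ⊆ z ∷ remove z L
    L⊆ {w} w∈L with w ≟ z
    ... | yes w≡z = here w≡z
    ... | no w≢z = there (∈-remove⁺ w∈L w≢z)

  unique⇒length≤n : ∀ {L : List (Fin n)} → Unique L → length L ≤ n
  unique⇒length≤n L! = ≤-trans (unique-⊆⇒length≤ L! (λ {z} _ → ∈-allFin z))
                                (≤-reflexive (length-tabulate (λ i → i)))

  ∉-∷∷ : ∀ {z a b : Fin n} {L} → z ≢ a → z ≢ b → z ∉ L → z ∉ a ∷ b ∷ L
  ∉-∷∷ z≢a z≢b z∉L (here z≡a) = z≢a z≡a
  ∉-∷∷ z≢a z≢b z∉L (there (here z≡b)) = z≢b z≡b
  ∉-∷∷ z≢a z≢b z∉L (there (there z∈L)) = z∉L z∈L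

  two-distinct : ∀ {L : List (Fin n)} → Unique L → 2 ≤ length L → ∃[ a ] ∃[ b ] a ∈ L × b ∈ L × a ≢ b
  two-distinct {a ∷ b ∷ _} ((a≢b ∷ _) ∷ _) _ = a , b , here refl , there (here refl) , a≢b
  two-distinct {_ ∷ []} _ (s≤s ())

  length-endpoints : ∀ (M : List (Edge n)) → length (endpoints M) ≡ length M * 2
  length-endpoints [] = refl
  length-endpoints (_ ∷ M) = cong (λ k → suc (suc k)) (length-endpoints M)

  ∈-endpoints : ∀ {u v} {M : List (Edge n)} → (u , v) ∈ M → u ∈ endpoints M × v ∈ endpoints M
  ∈-endpoints {M = _ ∷ _} (here refl) = here refl , there (here refl)
  ∈-endpoints {M = _ ∷ _} (there e∈M) with ∈-endpoints e∈M
  ... | u∈ , v∈ = there (there u∈) , there (there v∈)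

  free : List (Edge n) → List (Fin n)
  free M = filter (λ v → ¬? (v ∈? endpoints M)) (allFin n)

  ∈-free⁺ : ∀ {M : List (Edge n)} {v} → v ∉ endpoints M → v ∈ free M
  ∈-free⁺ {M = M} {v} = ∈-filter⁺ (λ v → ¬? (v ∈? endpoints M)) (∈-allFin v)

  ∈-free⁻ : ∀ {M : List (Edge n)} {v} → v ∈ free M → v ∉ endpoints M
  ∈-free⁻ {M = M} v∈ = proj₂ (∈-filter⁻ (λ v → ¬? (v ∈? endpoints M)) {xs = allFin n} v∈)

  ∈-free≡⁻ : ∀ {M : List (Edge n)} {L v} → free M ≡ L → v ∈ L → v ∉ endpoints M
  ∈-free≡⁻ {M} refl = ∈-free⁻ {M = M}

  free-unique : ∀ (M : List (Edge n)) → Unique (free M)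
  free-unique M = Unique.filter⁺ (λ v → ¬? (v ∈? endpoints M)) (Unique.allFin⁺ n)

  free-count : ∀ (M : List (Edge n)) → Unique (endpoints M) → length (free M) + length M * 2 ≡ n
  free-count M M! = begin
    length (free M) + length M * 2          ≡⟨ cong (length (free M) +_) (length-endpoints M) ⟨
    length (free M) + length (endpoints M)  ≡⟨ +-comm (length (free M)) _ ⟩
    length (endpoints M) + length (free M)  ≡⟨ length-++ (endpoints M) ⟨
    length (endpoints M ++ free M)          ≡⟨ unique-⊆⊇⇒length≡ all! (Unique.allFin⁺ n) (λ {v} _ → ∈-allFin v) cover ⟩
    length (allFin n)                       ≡⟨ length-tabulate (λ i → i) ⟩
    n                                       ∎
    where
    open ≡-Reasoning
    all! : Unique (endpoints M ++ free M)
    all! = Unique.++⁺ M! (free-unique M) (λ (v∈ , v∈free) → ∈-free⁻ {M = M} v∈free v∈)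
    cover : allFin n ⊆ endpoints M ++ free M
    cover {v} _ with v ∈? endpoints M
    ... | yes v∈ = ∈-++⁺ˡ v∈
    ... | no v∉ = ∈-++⁺ʳ (endpoints M) (∈-free⁺ {M = M} v∉)

  free-outside : (a b c : Fin n) → List (Edge n) → List (Fin n)
  free-outside a b c M = remove c (remove b (remove a (free M)))

  free-outside-unique : ∀ {a b c} M → Unique (free-outside a b c M)
  free-outside-unique M = remove-unique (remove-unique (remove-unique (free-unique M)))

  ∈-free-outside⁻ : ∀ {a b c M v} → v ∈ free-outside a b c M → v ∉ endpoints M × Outside a b c v
  ∈-free-outside⁻ {M = M} v∈ with ∈-remove⁻ v∈
  ... | v∈₂ , v≢c with ∈-remove⁻ v∈₂
  ... | v∈₁ , v≢b with ∈-remove⁻ v∈₁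
  ... | v∈free , v≢a = ∈-free⁻ {M = M} v∈free , v≢a , v≢b , v≢c

  length-free-outside : ∀ {a b c M} → a ≢ b → a ≢ c → b ≢ c →
                        (∀ {v} → v ∈ a ∷ b ∷ c ∷ [] → v ∉ endpoints M) →
                        length (free M) ≡ 3 + length (free-outside a b c M)
  length-free-outside {a} {b} {c} {M} a≢b a≢c b≢c abc∉ = begin
    length (free M)                            ≡⟨ length-remove (free-unique M) (abc-free (here refl)) ⟩
    1 + length (remove a (free M))             ≡⟨ cong suc (length-remove (remove-unique (free-unique M))
                                                      (∈-remove⁺ (abc-free (there (here refl))) (≢-sym a≢b))) ⟩
    2 + length (remove b (remove a (free M)))  ≡⟨ cong (λ k → suc (suc k))
                                                      (length-remove (remove-unique (remove-unique (free-unique M)))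
                                                        (∈-remove⁺ (∈-remove⁺ (abc-free (there (there (here refl))))
                                                                               (≢-sym a≢c)) (≢-sym b≢c))) ⟩
    3 + length (free-outside a b c M)          ∎
    where
    open ≡-Reasoning
    abc-free : ∀ {v} → v ∈ a ∷ b ∷ c ∷ [] → v ∈ free M
    abc-free v∈ = ∈-free⁺ {M = M} (abc∉ v∈)

  free-outside-empty : ∀ {a b c M v} → length (free-outside a b c M) ≡ 0 →
                       v ∉ endpoints M → v ∈ a ∷ b ∷ c ∷ []
  free-outside-empty {a} {b} {c} {M} {v} empty v∉ with v ≟ a | v ≟ b | v ≟ c
  ... | yes v≡a | _ | _ = here v≡a
  ... | no _ | yes v≡b | _ = there (here v≡b)
  ... | no _ | no _ | yes v≡c = there (there (here v≡c))
  ... | no v≢a | no v≢b | no v≢c = ⊥-elim (<-irrefl refl (subst (0 <_) empty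
        (∈-length (∈-remove⁺ (∈-remove⁺ (∈-remove⁺ (∈-free⁺ {M = M} v∉) v≢a) v≢b) v≢c))))

  closed-even : ∀ {M : List (Edge n)} {L} → Unique (endpoints M) → Unique L → L ⊆ endpoints M →
                (∀ {u v} → (u , v) ∈ M → (u ∈ L ⇔ v ∈ L)) → ∃[ k ] length L ≡ k * 2
  closed-even {M} {L} M! L! L⊆M closed = map₂ (trans L≡filter) (even M closed)
    where
    L≡filter : length L ≡ length (filter (_∈? L) (endpoints M))
    L≡filter = unique-⊆⊇⇒length≡ L! (Unique.filter⁺ (_∈? L) M!)
      (λ v∈L → ∈-filter⁺ (_∈? L) (L⊆M v∈L) v∈L) (λ v∈ → proj₂ (∈-filter⁻ (_∈? L) {xs = endpoints M} v∈))
    even : ∀ M′ → (∀ {u v} → (u , v) ∈ M′ → (u ∈ L ⇔ v ∈ L)) →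
           ∃[ k ] length (filter (_∈? L) (endpoints M′)) ≡ k * 2
    even [] _ = 0 , refl
    even ((u , v) ∷ M′) closed′ with even M′ (λ e∈ → closed′ (there e∈)) | u ∈? L
    ... | k , len | yes u∈ with v ∈? L
    ...   | yes _ = suc k , cong (λ m → suc (suc m)) len
    ...   | no v∉ = ⊥-elim (v∉ (Equivalence.to (closed′ (here refl)) u∈))
    even ((u , v) ∷ M′) closed′ | k , len | no u∉ with v ∈? L
    ...   | yes v∈ = ⊥-elim (u∉ (Equivalence.from (closed′ (here refl)) v∈))
    ...   | no _ = k , len

Odd[m+k*2]⇒Odd[m] : ∀ m k → Odd (m + k * 2) → Odd m
Odd[m+k*2]⇒Odd[m] m k = trans (sym ([m+kn]%n≡m%n m k 2))

¬Odd[k*2] : ∀ k → ¬ Odd (k * 2)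
¬Odd[k*2] k odd with Odd[m+k*2]⇒Odd[m] 0 k odd
... | ()

length≡3 : ∀ {A : Set} (L : List A) → length L ≡ 3 → ∃[ a ] ∃[ b ] ∃[ c ] L ≡ a ∷ b ∷ c ∷ []
length≡3 (a ∷ b ∷ c ∷ []) _ = a , b , c , refl

outside⇒∉ : ∀ {n} {a b c v : Fin n} → Outside a b c v → v ∉ a ∷ b ∷ c ∷ []
outside⇒∉ (v≢a , _ , _) (here v≡a) = v≢a v≡a
outside⇒∉ (_ , v≢b , _) (there (here v≡b)) = v≢b v≡b
outside⇒∉ (_ , _ , v≢c) (there (there (here v≡c))) = v≢c v≡c

odd-cases : ∀ m → Odd m → m ≡ 1 ⊎ ∃[ l ] m ≡ 3 + l
odd-cases 1 _ = inj₁ refl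
odd-cases (suc (suc (suc l))) _ = inj₂ (l , refl)

outside? : ∀ {n} (a b c : Fin n) → Decidable (Outside a b c)
outside? a b c v = ¬? (v ≟ a) ×-dec ¬? (v ≟ b) ×-dec ¬? (v ≟ c)

free-odd : ∀ {n} → Odd n → ∀ (M : List (Edge n)) → Unique (endpoints M) → Odd (length (free M))
free-odd odd-n M M! = Odd[m+k*2]⇒Odd[m] (length (free M)) (length M) (subst Odd (sym (free-count M M!)) odd-n)

module _ {n : ℕ} (G : Graph n) where

  open import Data.List.Membership.DecPropositional (_≟_ {n}) using (_∈?_)

  adj-sym : ∀ {u v} → Adj G u v → Adj G v u
  adj-sym {u} {v} uv = trans (adj-comm G v u) uv

  adj⇒≢ : ∀ {u v} → Adj G u v → u ≢ v
  adj⇒≢ {u} uu refl with trans (sym uu) (irrefl G u)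
  ... | ()

  reach-source : ∀ {P u v} → Reach G P u v → P u
  reach-source (here Pu) = Pu
  reach-source (step r _ _) = reach-source r

  reach-target : ∀ {P u v} → Reach G P u v → P v
  reach-target (here Pv) = Pv
  reach-target (step _ _ Pv) = Pv

  EdgeIn : (Fin n → Set) → Edge n → Set
  EdgeIn S (u , v) = Adj G u v × S u × S v

  IsMatchingIn : (Fin n → Set) → List (Edge n) → Set
  IsMatchingIn S M = All (EdgeIn S) M × Unique (endpoints M)

  endpoint-in : ∀ {S M z} → All (EdgeIn S) M → z ∈ endpoints M → S z
  endpoint-in {M = _ ∷ _} ((_ , Su , _) ∷ _) (here refl) = Su
  endpoint-in {M = _ ∷ _} ((_ , _ , Sv) ∷ _) (there (here refl)) = Sv
  endpoint-in {M = _ ∷ _} (_ ∷ M-in) (there (there z∈)) = endpoint-in M-in z∈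

  length-matching≤ : ∀ {S M} → IsMatchingIn S M → length M * 2 ≤ n
  length-matching≤ {M = M} (_ , M!) = subst (_≤ n) (length-endpoints M) (unique⇒length≤n M!)

  matching-∷ : ∀ {S M u v} → IsMatchingIn S M → Adj G u v → S u → S v →
               u ∉ endpoints M → v ∉ endpoints M → IsMatchingIn S ((u , v) ∷ M)
  matching-∷ {M = M} (M-in , M!) uv Su Sv u∉ v∉ =
    (uv , Su , Sv) ∷ M-in ,
    (adj⇒≢ uv ∷ ¬Any⇒All¬ (endpoints M) u∉) ∷ ¬Any⇒All¬ (endpoints M) v∉ ∷ M!

  matchingIn⇒matching : ∀ {S M} → IsMatchingIn S M → IsMatching G M
  matchingIn⇒matching (M-in , M!) = All.map (λ { {u , v} (uv , _ , _) → uv }) M-in , M!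

  matching⇒matchingIn : ∀ {M} → IsMatching G M → IsMatchingIn (λ _ → ⊤) M
  matching⇒matchingIn (M-adj , M!) = All.map (λ { {u , v} uv → uv , tt , tt }) M-adj , M!

  independent3-∈ : ∀ {a b c u v} → Independent3 G a b c →
                   u ∈ a ∷ b ∷ c ∷ [] → v ∈ a ∷ b ∷ c ∷ [] → ¬ Adj G u v
  independent3-∈ (_ , _ , _ , ¬ab , ¬ac , ¬bc) = λ where
    (here refl)                (here refl)                uv → adj⇒≢ uv refl
    (here refl)                (there (here refl))        uv → ¬ab uv
    (here refl)                (there (there (here refl))) uv → ¬ac uv
    (there (here refl))        (here refl)                uv → ¬ab (adj-sym uv)
    (there (here refl))        (there (here refl))        uv → adj⇒≢ uv refl
    (there (here refl))        (there (there (here refl))) uv → ¬bc uv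
    (there (there (here refl))) (here refl)               uv → ¬ac (adj-sym uv)
    (there (there (here refl))) (there (here refl))       uv → ¬bc (adj-sym uv)
    (there (there (here refl))) (there (there (here refl))) uv → adj⇒≢ uv refl

  record Partner (S : Fin n → Set) (M : List (Edge n)) (w : Fin n) : Set where
    field
      mate     : Fin n
      rest     : List (Edge n)
      matching : IsMatchingIn S ((w , mate) ∷ rest)
      length≡  : length M ≡ suc (length rest)
      ⊆cover   : endpoints M ⊆ endpoints ((w , mate) ∷ rest)
      ⊇cover   : endpoints ((w , mate) ∷ rest) ⊆ endpoints M

  partner : ∀ {S M w} → IsMatchingIn S M → w ∈ endpoints M → Partner S M w
  partner {M = (u , v) ∷ M₁} m (here refl) = record
    { mate = v ; rest = M₁ ; matching = m ; length≡ = refl ; ⊆cover = λ z∈ → z∈ ; ⊇cover = λ z∈ → z∈ }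
  partner {M = (u , v) ∷ M₁} ((uv , Su , Sv) ∷ M₁-in , (u≢v ∷ u∉) ∷ v∉ ∷ M₁!) (there (here refl)) = record
    { mate = u ; rest = M₁
    ; matching = (adj-sym uv , Sv , Su) ∷ M₁-in , ((λ v≡u → u≢v (sym v≡u)) ∷ v∉) ∷ u∉ ∷ M₁!
    ; length≡ = refl ; ⊆cover = swap ; ⊇cover = swap }
    where
    swap : ∀ {a b} → a ∷ b ∷ endpoints M₁ ⊆ b ∷ a ∷ endpoints M₁
    swap (here z≡a) = there (here z≡a)
    swap (there (here z≡b)) = here z≡b
    swap (there (there z∈)) = there (there z∈)
  partner {M = (u , v) ∷ M₁} {w} ((uv , Su , Sv) ∷ M₁-in , (_ ∷ u∉) ∷ v∉ ∷ M₁!) (there (there w∈))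
    with partner (M₁-in , M₁!) w∈
  ... | record { mate = q ; rest = R ; matching = (wq , Sw , Sq) ∷ R-in , (_ ∷ w∉R) ∷ q∉R ∷ R!
               ; length≡ = len ; ⊆cover = sub ; ⊇cover = sup } = record
    { mate = q ; rest = (u , v) ∷ R
    ; matching = matching-∷ (matching-∷ (R-in , R!) uv Su Sv (λ u∈ → u∉M₁ (sup (there (there u∈))))
                                                             (λ v∈ → v∉M₁ (sup (there (there v∈)))))
                            wq Sw Sq (∉-∷∷ (∈-∉⇒≢ w∈ u∉M₁) (∈-∉⇒≢ w∈ v∉M₁) (All¬⇒¬Any w∉R))
                                     (∉-∷∷ (∈-∉⇒≢ q∈ u∉M₁) (∈-∉⇒≢ q∈ v∉M₁) (All¬⇒¬Any q∉R))
    ; length≡ = cong suc len ; ⊆cover = sub′ ; ⊇cover = sup′ }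
    where
    u∉M₁ = All¬⇒¬Any u∉
    v∉M₁ = All¬⇒¬Any v∉
    q∈ : q ∈ endpoints M₁
    q∈ = sup (there (here refl))
    sub′ : u ∷ v ∷ endpoints M₁ ⊆ w ∷ q ∷ u ∷ v ∷ endpoints R
    sub′ (here z≡u) = there (there (here z≡u))
    sub′ (there (here z≡v)) = there (there (there (here z≡v)))
    sub′ (there (there z∈)) with sub z∈
    ... | here z≡w = here z≡w
    ... | there (here z≡q) = there (here z≡q)
    ... | there (there z∈R) = there (there (there (there z∈R)))
    sup′ : w ∷ q ∷ u ∷ v ∷ endpoints R ⊆ u ∷ v ∷ endpoints M₁
    sup′ (here z≡w) = there (there (sup (here z≡w)))
    sup′ (there (here z≡q)) = there (there (sup (there (here z≡q))))
    sup′ (there (there (here z≡u))) = here z≡u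
    sup′ (there (there (there (here z≡v)))) = there (here z≡v)
    sup′ (there (there (there (there z∈R)))) = there (there (sup (there (there z∈R))))

  record Augmentation (S : Fin n → Set) (M : List (Edge n)) (y : Fin n) : Set where
    field
      matching′  : List (Edge n)
      isMatching : IsMatchingIn S matching′
      length≡    : length matching′ ≡ suc (length M)
      covers     : endpoints M ⊆ endpoints matching′
      covers-y   : y ∈ endpoints matching′

  augmentation-∷ : ∀ {S M w y} → IsMatchingIn S M → Adj G w y → S w → S y →
                   w ∉ endpoints M → y ∉ endpoints M → Augmentation S M y
  augmentation-∷ {M = M} {w} {y} m wy Sw Sy w∉ y∉ = record
    { matching′ = (w , y) ∷ M ; isMatching = matching-∷ m wy Sw Sy w∉ y∉ ; length≡ = refl
    ; covers = λ z∈ → there (there z∈) ; covers-y = there (here refl) }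

  augmentation-via : ∀ {S M y t} M′ → length M′ ≡ length M → endpoints M ⊆ t ∷ endpoints M′ →
                     y ∈ endpoints M′ → Augmentation S M′ t → Augmentation S M y
  augmentation-via {M = M} M′ len cover y∈ A = record
    { matching′ = matching′ ; isMatching = isMatching ; length≡ = trans length≡ (cong suc len)
    ; covers = covers′ ; covers-y = covers y∈ }
    where
    open Augmentation A
    covers′ : endpoints M ⊆ endpoints matching′
    covers′ z∈ with cover z∈
    ... | here refl = covers-y
    ... | there z∈M′ = covers z∈M′

  rematch-mate : ∀ {S M w y} (P : Partner S M w) → let open Partner P in
                 Augmentation S ((w , y) ∷ rest) mate → Augmentation S M y
  rematch-mate {M = M} {w} {y} P = augmentation-via ((w , y) ∷ rest) (sym length≡) cover (there (here refl))
    where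
    open Partner P
    cover : endpoints M ⊆ mate ∷ w ∷ y ∷ endpoints rest
    cover z∈ with ⊆cover z∈
    ... | here z≡w = there (here z≡w)
    ... | there (here z≡q) = here z≡q
    ... | there (there z∈R) = there (there (there z∈R))

  rematch-vertex : ∀ {S M w y} (P : Partner S M w) → let open Partner P in
                   Augmentation S ((y , mate) ∷ rest) w → Augmentation S M y
  rematch-vertex {M = M} {w} {y} P = augmentation-via ((y , mate) ∷ rest) (sym length≡) cover (here refl)
    where
    open Partner P
    cover : endpoints M ⊆ w ∷ y ∷ mate ∷ endpoints rest
    cover z∈ with ⊆cover z∈
    ... | here z≡w = here z≡w
    ... | there (here z≡q) = there (there (here z≡q))
    ... | there (there z∈R) = there (there (there z∈R))

  length-free-augmentation : ∀ {S M y} (A : Augmentation S M y) → Unique (endpoints M) →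
                      length (free M) ≡ 2 + length (free (Augmentation.matching′ A))
  length-free-augmentation {M = M} A M! = +-cancelʳ-≡ (length M * 2) _ _ (begin
    length (free M) + length M * 2             ≡⟨ free-count M M! ⟩
    n                                          ≡⟨ free-count matching′ (proj₂ isMatching) ⟨
    length (free matching′) + length matching′ * 2
                                               ≡⟨ cong (λ k → length (free matching′) + k * 2) length≡ ⟩
    length (free matching′) + suc (suc (length M * 2))
                                               ≡⟨ trans (+-suc _ _) (cong suc (+-suc _ _)) ⟩
    2 + length (free matching′) + length M * 2 ∎)
    where
    open Augmentation A
    open ≡-Reasoning

  module _ (claw-free : ClawFree G) {S : Fin n → Set} where

    augment-along : ∀ {x w y} M → IsMatchingIn S M → x ∉ endpoints M → y ∉ endpoints M → x ≢ y →
                    Reach G S x w → Adj G w y → S y → Augmentation S M y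

    augment-reach : ∀ {x t y} M → IsMatchingIn S M → x ∉ endpoints M → y ∉ endpoints M → x ≢ y →
                    Reach G S x t → t ≡ y → Augmentation S M y
    augment-reach M m x∉ y∉ x≢y (here _) refl = ⊥-elim (x≢y refl)
    augment-reach M m x∉ y∉ x≢y (step r wy Sy) refl = augment-along M m x∉ y∉ x≢y r wy Sy

    augment-along M m x∉ y∉ x≢y (here Sx) xy Sy = augmentation-∷ m xy Sx Sy x∉ y∉
    augment-along {x} {w} {y} M m x∉ y∉ x≢y (step {p} r pw Sw) wy Sy with w ∈? endpoints M
    ... | no w∉ = augmentation-∷ m wy Sw Sy w∉ y∉
    ... | yes w∈ with partner m w∈
    ... | P@record { mate = q ; rest = R ; matching = (wq , _ , Sq) ∷ R-in , (w≢q ∷ w∉R) ∷ q∉R ∷ R!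
                   ; ⊇cover = sup } = by-claw
      where
      q∈ : q ∈ endpoints M
      q∈ = sup (there (here refl))
      x∉R : x ∉ endpoints R
      x∉R z∈ = x∉ (sup (there (there z∈)))
      y∉R : y ∉ endpoints R
      y∉R z∈ = y∉ (sup (there (there z∈)))
      x≢w : x ≢ w
      x≢w = ≢-sym (∈-∉⇒≢ w∈ x∉)
      x≢q : x ≢ q
      x≢q = ≢-sym (∈-∉⇒≢ q∈ x∉)
      y≢q : y ≢ q
      y≢q = ≢-sym (∈-∉⇒≢ q∈ y∉)

      m-wy : IsMatchingIn S ((w , y) ∷ R)
      m-wy = matching-∷ (R-in , R!) wy Sw Sy (All¬⇒¬Any w∉R) y∉R
      x∉wy : x ∉ endpoints ((w , y) ∷ R)
      x∉wy = ∉-∷∷ x≢w x≢y x∉R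
      q∉wy : q ∉ endpoints ((w , y) ∷ R)
      q∉wy = ∉-∷∷ (≢-sym w≢q) (≢-sym y≢q) (All¬⇒¬Any q∉R)

      along-yq : Adj G y q → Augmentation S M y
      along-yq yq = rematch-vertex P (augment-along ((y , q) ∷ R)
        (matching-∷ (R-in , R!) yq Sy Sq y∉R (All¬⇒¬Any q∉R))
        (∉-∷∷ x≢y x≢q x∉R) (∉-∷∷ (adj⇒≢ wy) w≢q (All¬⇒¬Any w∉R)) x≢w r pw Sw)

      -- w, matched to q, is the centre of a claw on p, y, q unless one of the edges py, pq, yq exists
      by-claw : Augmentation S M y
      by-claw with q ≟ p
      ... | yes q≡p = rematch-mate P (augment-reach ((w , y) ∷ R) m-wy x∉wy q∉wy x≢q r (sym q≡p))
      ... | no q≢p with p ≟ y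
      ...   | yes p≡y = augment-reach M m x∉ y∉ x≢y r p≡y
      ...   | no p≢y with adj G p y ≟ᵇ true
      ...     | yes py = augment-along M m x∉ y∉ x≢y r py Sy
      ...     | no ¬py with adj G p q ≟ᵇ true
      ...       | yes pq = rematch-mate P (augment-along ((w , y) ∷ R) m-wy x∉wy q∉wy x≢q r pq Sq)
      ...       | no ¬pq with adj G y q ≟ᵇ true
      ...         | yes yq = along-yq yq
      ...         | no ¬yq = ⊥-elim (claw-free w p y q (adj-sym pw) wy wq p≢y (≢-sym q≢p) y≢q
                                                 (¬py , ¬pq , ¬yq))

  component : ∀ {P : Fin n → Set} → Decidable P → ∀ {x} → P x → ∃[ m ] ComponentSize G P x m
  component {P} P? {x} Px = grow n (x ∷ []) ([] ∷ []) (λ { (here refl) → here Px }) (here refl) (n≤1+n n)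
    where
    -- the fuel f bounds how often L can still grow, since a duplicate-free L has at most n elements
    grow : (f : ℕ) (L : List (Fin n)) → Unique L → (∀ {v} → v ∈ L → Reach G P x v) → x ∈ L →
           n ≤ length L + f → ∃[ m ] ComponentSize G P x m
    grow f L L! reach x∈L bound
      with any? (λ v → ¬? (v ∈? L) ×-dec P? v ×-dec any? (λ w → adj G w v ≟ᵇ true) L) (allFin n)
    ... | no none = length L , L , L! , (λ v → mk⇔ reach complete) , refl
      where
      complete : ∀ {v} → Reach G P x v → v ∈ L
      complete (here _) = x∈L
      complete {v} (step r wv Pv) with v ∈? L
      ... | yes v∈L = v∈L
      ... | no v∉L = ⊥-elim (none (lose (∈-allFin v) (v∉L , Pv , lose (complete r) wv)))
    ... | yes some with satisfied some
    ...   | v , v∉L , Pv , adjacent with find adjacent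
    ...     | w , w∈L , wv with f
    ...       | zero = ⊥-elim (<-irrefl refl (≤-trans (unique⇒length≤n (¬Any⇒All¬ L v∉L ∷ L!))
                                                  (≤-trans bound (≤-reflexive (+-identityʳ (length L))))))
    ...       | suc f = grow f (v ∷ L) (¬Any⇒All¬ L v∉L ∷ L!) reach′ (there x∈L)
                             (≤-trans bound (≤-reflexive (+-suc (length L) f)))
      where
      reach′ : ∀ {u} → u ∈ v ∷ L → Reach G P x u
      reach′ (here refl) = step (reach w∈L) wv Pv
      reach′ (there u∈L) = reach u∈L

  reach? : ∀ {P : Fin n → Set} → Decidable P → ∀ x y → Dec (Reach G P x y)
  reach? P? x y with P? x
  ... | no ¬Px = no (λ r → ¬Px (reach-source r))
  ... | yes Px with component P? Px
  ... | _ , L , _ , L⇔ , _ = map′ (Equivalence.to (L⇔ y)) (Equivalence.from (L⇔ y)) (y ∈? L)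

  component-closed : ∀ {S x M} {L : List (Fin n)} → (∀ v → v ∈ L ⇔ Reach G S x v) →
                     All (EdgeIn S) M → ∀ {u v} → (u , v) ∈ M → (u ∈ L ⇔ v ∈ L)
  component-closed L⇔ M-in e∈M with All.lookup M-in e∈M
  ... | uv , Su , Sv = mk⇔ (λ u∈L → from (step (to u∈L) uv Sv)) (λ v∈L → from (step (to v∈L) (adj-sym uv) Su))
    where open module L⇔ {v} = Equivalence (L⇔ v)

  Separating : (Fin n → Set) → List (Edge n) → Set
  Separating S M = ∀ x y → x ∉ endpoints M → y ∉ endpoints M → x ≢ y → ¬ Reach G S x y

  separating-matching : ClawFree G → ∀ {S} → Decidable S → ∃[ M ] IsMatchingIn S M × Separating S M
  separating-matching claw-free {S} S? = improve n [] ([] , []) ≤-refl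
    where
    improve : (f : ℕ) (M : List (Edge n)) → IsMatchingIn S M → n ≤ length M + f →
              ∃[ M ] IsMatchingIn S M × Separating S M
    improve f M m bound
      with any? (λ x → any? (λ y → ¬? (x ∈? endpoints M) ×-dec ¬? (y ∈? endpoints M) ×-dec ¬? (x ≟ y)
                                    ×-dec reach? S? x y) (allFin n)) (allFin n)
    ... | no none = M , m , λ x y x∉ y∉ x≢y r →
                      none (lose (∈-allFin x) (lose (∈-allFin y) (x∉ , y∉ , x≢y , r)))
    ... | yes some with satisfied some
    ...   | x , some-y with satisfied some-y
    ...     | y , x∉ , y∉ , x≢y , r with augment-reach claw-free M m x∉ y∉ x≢y r refl | f
    ...       | A | zero = ⊥-elim (<-irrefl refl (begin-strict
                  length M              <⟨ m≤m*n (suc (length M)) 2 ⟩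
                  suc (length M) * 2    ≡⟨ cong (_* 2) length≡ ⟨
                  length matching′ * 2  ≤⟨ length-matching≤ isMatching ⟩
                  n                     ≤⟨ bound ⟩
                  length M + 0          ≡⟨ +-identityʳ (length M) ⟩
                  length M              ∎))
      where
      open Augmentation A
      open ≤-Reasoning
    ...       | A | suc f = improve f matching′ isMatching
                  (≤-trans bound (≤-reflexive (trans (+-suc (length M) f) (cong (_+ f) (sym length≡)))))
      where open Augmentation A

  -- by separation x is the only free vertex of its component, and M pairs up the others
  free-component-odd : ∀ {S M x} → Decidable S → IsMatchingIn S M → Separating S M →
                       x ∉ endpoints M → S x → OddComponent G S x
  free-component-odd {S} {M} {x} S? (M-in , M!) sep x∉ Sx with component S? Sx
  ... | m , L , L! , L⇔ , refl with closed-even M! (remove-unique {z = x} L!) L′⊆M closed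
    where
    L′⊆M : remove x L ⊆ endpoints M
    L′⊆M {v} v∈ with ∈-remove⁻ v∈ | v ∈? endpoints M
    ... | _ | yes v∈M = v∈M
    ... | v∈L , v≢x | no v∉M = ⊥-elim (sep x v x∉ v∉M (≢-sym v≢x) (Equivalence.to (L⇔ v) v∈L))
    closed : ∀ {u v} → (u , v) ∈ M → (u ∈ remove x L ⇔ v ∈ remove x L)
    closed e∈M with component-closed L⇔ M-in e∈M | ∈-endpoints e∈M
    ... | u⇔v | u∈M , v∈M = mk⇔
      (λ u∈ → ∈-remove⁺ (Equivalence.to u⇔v (proj₁ (∈-remove⁻ u∈))) (∈-∉⇒≢ v∈M x∉))
      (λ v∈ → ∈-remove⁺ (Equivalence.from u⇔v (proj₁ (∈-remove⁻ v∈))) (∈-∉⇒≢ u∈M x∉))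
  ... | k , len = Sx , length L , (L , L! , L⇔ , refl) ,
    subst Odd (sym (trans (length-remove L! (Equivalence.from (L⇔ x) (here Sx))) (cong suc len)))
          ([m+kn]%n≡m%n 1 k 2)

  free-independent : ∀ {M₀ M a b c} → IsMaximalMatching G M₀ → endpoints M₀ ⊆ endpoints M →
                     free M ≡ a ∷ b ∷ c ∷ [] → Independent3 G a b c
  free-independent {M₀} {M} {a} {b} {c} maximal₀ M₀⊆M free≡abc with subst Unique free≡abc (free-unique M)
  ... | (a≢b ∷ a≢c ∷ []) ∷ (b≢c ∷ []) ∷ [] ∷ [] =
    a≢b , a≢c , b≢c , non-adjacent (here refl) (there (here refl)) ,
    non-adjacent (here refl) (there (there (here refl))) ,
    non-adjacent (there (here refl)) (there (there (here refl)))
    where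
    free₀ : ∀ {v} → v ∈ a ∷ b ∷ c ∷ [] → v ∉ endpoints M₀
    free₀ v∈ v∈₀ = ∈-free≡⁻ {M = M} free≡abc v∈ (M₀⊆M v∈₀)
    non-adjacent : ∀ {u v} → u ∈ a ∷ b ∷ c ∷ [] → v ∈ a ∷ b ∷ c ∷ [] → ¬ Adj G u v
    non-adjacent u∈ v∈ uv = proj₂ maximal₀ _ _ uv (free₀ u∈) (free₀ v∈)

  only-even-components : ∀ {M a b c x} → IsMatchingIn (λ _ → ⊤) M → free M ≡ a ∷ b ∷ c ∷ [] →
                         ¬ OddComponent G (Outside a b c) x
  only-even-components {M} {a} {b} {c} (M-in , M!) free≡abc (_ , m , (L , L! , L⇔ , refl) , odd)
    with closed-even M! L! L⊆M closed
    where
    outside : ∀ {v} → v ∈ endpoints M → Outside a b c v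
    outside v∈ = (λ v≡a → ∈-free≡⁻ {M = M} free≡abc (here v≡a) v∈) ,
                 (λ v≡b → ∈-free≡⁻ {M = M} free≡abc (there (here v≡b)) v∈) ,
                 (λ v≡c → ∈-free≡⁻ {M = M} free≡abc (there (there (here v≡c))) v∈)
    L⊆M : L ⊆ endpoints M
    L⊆M {v} v∈L with v ∈? endpoints M
    ... | yes v∈M = v∈M
    ... | no v∉M = ⊥-elim (outside⇒∉ (reach-target (Equivalence.to (L⇔ v) v∈L))
                                      (subst (v ∈_) free≡abc (∈-free⁺ {M = M} v∉M)))
    closed : ∀ {u v} → (u , v) ∈ M → (u ∈ L ⇔ v ∈ L)
    closed = component-closed L⇔ (All.tabulate λ { {u , v} e∈M →
      proj₁ (All.lookup M-in e∈M) , outside (proj₁ (∈-endpoints e∈M)) , outside (proj₂ (∈-endpoints e∈M)) })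
  ... | k , even = ¬Odd[k*2] k (subst Odd even odd)

OddComponentCondition : ∀ {n} → Graph n → Set
OddComponentCondition G = ∀ a b c → Independent3 G a b c → AtLeastTwoOddComponents G (Outside a b c)

module _ {n : ℕ} {G : Graph n} (claw-free : ClawFree G) (connected : Connected G) (odd-n : Odd n) where

  near-perfect-matching : ∃[ M ] IsMaximalMatching G M × suc (length M * 2) ≡ n
  near-perfect-matching with separating-matching G claw-free {λ _ → ⊤} (λ _ → yes tt)
  ... | M , m , sep = M , (matchingIn⇒matching G m , maximal) , trans (cong (_+ length M * 2) (sym one-free))
                                                                   (free-count M (proj₂ m))
    where
    free-equal : ∀ {a b} → a ∈ free M → b ∈ free M → a ≡ b
    free-equal {a} {b} a∈ b∈ with a ≟ b
    ... | yes a≡b = a≡b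
    ... | no a≢b = ⊥-elim (sep a b (∈-free⁻ {M = M} a∈) (∈-free⁻ {M = M} b∈) a≢b (connected a b))
    maximal : ∀ u v → Adj G u v → u ∉ endpoints M → v ∉ endpoints M → ⊥
    maximal u v uv u∉ v∉ = adj⇒≢ G uv (free-equal (∈-free⁺ {M = M} u∉) (∈-free⁺ {M = M} v∉))
    one-free : length (free M) ≡ 1
    one-free with odd-cases _ (free-odd odd-n M (proj₂ m))
    ... | inj₁ len = len
    ... | inj₂ (l , len) with two-distinct (free-unique M) (subst (2 ≤_) (sym len) (s≤s (s≤s z≤n)))
    ...   | a , b , a∈ , b∈ , a≢b = ⊥-elim (a≢b (free-equal a∈ b∈))

  module _ (condition : OddComponentCondition G) {M₀ : List (Edge n)} (maximal₀ : IsMaximalMatching G M₀) where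

    no-three-or-more-free : ∀ l {M} → IsMatchingIn G (λ _ → ⊤) M → endpoints M₀ ⊆ endpoints M →
                            length (free M) ≡ 3 + l → ⊥
    no-three-or-more-free zero {M} m M₀⊆M len with length≡3 (free M) len
    ... | a , b , c , free≡abc with condition a b c (free-independent G {M = M} maximal₀ M₀⊆M free≡abc)
    ...   | x , _ , odd-x , _ = only-even-components G m free≡abc odd-x
    no-three-or-more-free (suc zero) {M} (_ , M!) _ len with subst Odd len (free-odd odd-n M M!)
    ... | ()
    no-three-or-more-free (suc (suc l)) {M} m M₀⊆M len
      with two-distinct (free-unique M) (subst (2 ≤_) (sym len) (s≤s (s≤s z≤n)))
    ... | x , y , x∈ , y∈ , x≢y =
      no-three-or-more-free l isMatching (λ z∈ → covers (M₀⊆M z∈))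
        (suc-injective (suc-injective (trans (sym (length-free-augmentation G A (proj₂ m))) len)))
      where
      A = augment-reach G claw-free M m (∈-free⁻ {M = M} x∈) (∈-free⁻ {M = M} y∈) x≢y (connected x y) refl
      open Augmentation A

    maximal-near-perfect : suc (length M₀ * 2) ≡ n
    maximal-near-perfect with odd-cases _ (free-odd odd-n M₀ (proj₂ (proj₁ maximal₀)))
    ... | inj₁ len = trans (cong (_+ length M₀ * 2) (sym len)) (free-count M₀ (proj₂ (proj₁ maximal₀)))
    ... | inj₂ (l , len) =
      ⊥-elim (no-three-or-more-free l (matching⇒matchingIn G (proj₁ maximal₀)) (λ z∈ → z∈) len)

  equimatchable-size : Equimatchable G → ∀ {M} → IsMaximalMatching G M → suc (length M * 2) ≡ n
  equimatchable-size equimatchable {M} maximal with near-perfect-matching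
  ... | N , maximal-N , size-N = trans (cong (λ k → suc (k * 2)) (equimatchable M N maximal maximal-N)) size-N

  equimatchable⇒condition : Equimatchable G → OddComponentCondition G
  equimatchable⇒condition equimatchable a b c independent@(a≢b , a≢c , b≢c , _)
    with separating-matching G claw-free (outside? a b c)
  ... | M , m@(M-in , M!) , sep = by-count (length F) refl
    where
    F : List (Fin n)
    F = free-outside a b c M
    free-count-F : length (free M) ≡ 3 + length F
    free-count-F = length-free-outside {M = M} a≢b a≢c b≢c
                     (λ v∈ v∈M → outside⇒∉ (endpoint-in G M-in v∈M) v∈)

    by-count : ∀ k → length F ≡ k → AtLeastTwoOddComponents G (Outside a b c)
    by-count zero F≡0 with +-cancelʳ-≡ (length M * 2) 1 3 (trans (equimatchable-size equimatchable maximal)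
      (trans (sym (free-count M M!)) (cong (_+ length M * 2) (trans free-count-F (cong (3 +_) F≡0)))))
      where
      maximal : IsMaximalMatching G M
      maximal = matchingIn⇒matching G m , λ u v uv u∉ v∉ →
        independent3-∈ G independent (free-outside-empty {M = M} F≡0 u∉) (free-outside-empty {M = M} F≡0 v∉) uv
    ... | ()
    by-count (suc zero) F≡1 with subst Odd (trans free-count-F (cong (3 +_) F≡1)) (free-odd odd-n M M!)
    ... | ()
    by-count (suc (suc _)) F≡ with two-distinct (free-outside-unique M) (subst (2 ≤_) (sym F≡) (s≤s (s≤s z≤n)))
    ... | x , y , x∈F , y∈F , x≢y =
      x , y , odd x∈F , odd y∈F , sep x y (proj₁ (∈-free-outside⁻ {M = M} x∈F)) (proj₁ (∈-free-outside⁻ {M = M} y∈F)) x≢y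
      where
      odd : ∀ {v} → v ∈ F → OddComponent G (Outside a b c) v
      odd v∈F = free-component-odd G (outside? a b c) m sep (proj₁ (∈-free-outside⁻ {M = M} v∈F))
                                                           (proj₂ (∈-free-outside⁻ {M = M} v∈F))

  condition⇒equimatchable : OddComponentCondition G → Equimatchable G
  condition⇒equimatchable condition M M′ maximal maximal′ = *-cancelʳ-≡ _ _ 2 (suc-injective
    (trans (maximal-near-perfect condition maximal) (sym (maximal-near-perfect condition maximal′))))

lemma5 : ∀ {n} (G : Graph n) → Connected G → ClawFree G → Odd n →
    Equimatchable G ⇔
    (∀ a b c → Independent3 G a b c → AtLeastTwoOddComponents G (Outside a b c))
lemma5 G connected claw-free odd-n =
  mk⇔ (equimatchable⇒condition claw-free connected odd-n) (condition⇒equimatchable claw-free connected odd-n)
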